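{- There exists an infinite family of strings, containing strings of arbitrarily large length $n$, and a constant $C>0$ such that every string $w$ of length $n\ge 2$ in the family satisfies $\delta(w) \ge C\,\ell(w)\log n$; that is, $\delta = \Omega(\ell\log n)$ on this family.
   Context: For a string $w[1,n]$, let $S_w(k)$ be the number of distinct substrings of length $k$ of $w$, and $\delta(w) = \max\{S_w(k)/k : 1\le k\le n\}$. L-system: a tuple $L=(V,R,S,\tau,d,n)$ where $V$ is a finite set of variables, $R: V\to V^+$ assigns to each variable a nonempty string (extended homomorphically to strings), $S\in V^*$ is the axiom, $\tau: V\to V$ is a coding (letter-to-letter map, extended homomorphically), $d\in\mathbb{N}$ and $n\in\mathbb{N}$. Its levels are $L_0=S$ and $L_{i+1}=R(L_i)$; it generates the string $w[1,n]=\tau(L_d[1,n])$. Its size is $|S|+\sum_{A\in V}|R(A)|$. $\ell(w)$ is the size of the smallest L-system generating $w$. -}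

module Defs where

open import Data.Nat using (ℕ; zero; suc; _+_; _∸_; _≤_)
open import Data.Nat.Properties using (_≟_)
open import Data.Fin using (Fin)
open import Data.List using (List; []; _∷_; length; map; take; drop; upTo; concatMap; allFin; deduplicate; foldr)
open import Data.List.Properties using (≡-dec)
open import Data.Nat.ListAction using (sum)
open import Data.List.NonEmpty as L⁺ using (List⁺)
open import Data.Integer using (+_)
open import Data.Rational using (ℚ; 0ℚ; _/_; _⊔_)
open import Data.Product using (Σ; _×_)
open import Function.Definitions using (Injective)
open import Relation.Binary.PropositionalEquality using (_≡_)

Str : Set
Str = List ℕ

-- All length-k windows w[i+1 .. i+k] for 0 ≤ i ≤ |w| - k (none if k > |w|).
windows : ℕ → Str → List Str
windows k w = map (λ i → take k (drop i w)) (upTo (suc (length w) ∸ k))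

S : Str → ℕ → ℕ
S w k = length (deduplicate (≡-dec _≟_) (windows k w))

-- δ(w) = max { S_w(k)/k : 1 ≤ k ≤ |w| }  (0 for the empty string).
δ : Str → ℚ
δ w = foldr _⊔_ 0ℚ (map (λ i → (+ S w (suc i)) / suc i) (upTo (length w)))

-- An L-system. The finite variable set V is Fin v, each variable A being
-- the symbol 'name A' (names are injective, so V is a finite set of symbols).
record LSystem : Set where
  field
    v        : ℕ
    name     : Fin v → ℕ
    name-inj : Injective _≡_ _≡_ name
    R        : Fin v → List⁺ (Fin v)
    axiom    : List (Fin v)
    τ        : Fin v → Fin v
    d        : ℕ
    n        : ℕ

  Rˢ : List (Fin v) → List (Fin v)
  Rˢ = concatMap (λ A → L⁺.toList (R A))

  level : ℕ → List (Fin v)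
  level zero    = axiom
  level (suc i) = Rˢ (level i)

  -- the generated string τ(L_d[1,n]) (requires n ≤ |L_d|)
  output : Str
  output = map (λ A → name (τ A)) (take n (level d))

  size : ℕ
  size = length axiom + sum (map (λ A → L⁺.length (R A)) (allFin v))

open LSystem public

Generates : LSystem → Str → Set
Generates L w = (n L ≤ length (level L (d L))) × (output L ≡ w)

-- IsMinSize w m : m = ℓ(w), the size of a smallest L-system generating w.
IsMinSize : Str → ℕ → Set
IsMinSize w m =
  (Σ LSystem (λ L → Generates L w × size L ≡ m)) ×
  ((L : LSystem) → Generates L w → m ≤ size L)

module Submission where

-- The L-system a → a b, b → b, c → c a with axiom c has size 6, and its d-th level is
-- c · a · a b · a b² ⋯ a b^(d-1), so ℓ(w) ≤ 6 for the strings w of this shape with d = 3h + 1;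
-- their length is n ≤ 1 + d² ≤ 4^d, whence ⌊log₂ n⌋ ≤ 2d ≤ 8h.  A string b^p a b^q a b^r spanning
-- three consecutive blocks is an infix of w, and with p + q + r fixed the exponents p and q can be
-- chosen independently among h values each: this gives h² distinct infixes of length 4h, so
-- δ(w) ≥ h² / 4h = 6 · 8h / 192 ≥ ℓ(w) ⌊log₂ n⌋ / 192.

open import Defs
open import Data.Nat hiding (_⊔_; _/_)
open import Data.Nat.Properties
open import Data.Nat.Logarithm using (⌊log₂_⌋; ⌊log₂⌋-mono-≤; ⌊log₂[2^n]⌋≡n)
open import Data.Nat.Tactic.RingSolver using (solve-∀)
open import Data.Fin using (Fin; zero; suc; toℕ)
open import Data.Fin.Properties using (toℕ-injective)
open import Data.List hiding (lookup)
open import Data.List.Properties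
open import Data.List.NonEmpty as List⁺ using (List⁺; _∷_)
open import Data.List.Membership.Propositional using (_∈_)
open import Data.List.Membership.Propositional.Properties
open import Data.List.Relation.Binary.Subset.Propositional using (_⊆_)
open import Data.List.Relation.Unary.All using (lookup)
open import Data.List.Relation.Unary.AllPairs using (_∷_)
open import Data.List.Relation.Unary.Any using (here; there)
open import Data.List.Relation.Unary.Unique.Propositional using (Unique)
import Data.List.Relation.Unary.Unique.Propositional.Properties as Unique
open import Data.Integer using (+_)
import Data.Integer as ℤ
import Data.Integer.Properties as ℤ
open import Data.Rational as ℚ using (ℚ; 0ℚ; _/_; _⊔_)
import Data.Rational.Properties as ℚ
open import Data.Rational.Unnormalised as ℚᵘ using (mkℚᵘ; *≤*)
import Data.Rational.Unnormalised.Properties as ℚᵘ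
open import Data.Product using (Σ; ∃-syntax; _×_; _,_; uncurry)
open import Data.Product.Properties using (×-≡,≡→≡)
open import Data.Sum using (inj₁; inj₂)
open import Relation.Binary.PropositionalEquality
open import Relation.Nullary using (contradiction)
open import Tactic.MonoidSolver using (solve)

∈-++-∷-≢ : ∀ {A : Set} {z x : A} (us vs : List A) →
           z ∈ us ++ x ∷ vs → z ≢ x → z ∈ us ++ vs
∈-++-∷-≢ us vs z∈ z≢x with ∈-++⁻ us z∈
... | inj₁ z∈us         = ∈-++⁺ˡ z∈us
... | inj₂ (here z≡x)   = contradiction z≡x z≢x
... | inj₂ (there z∈vs) = ∈-++⁺ʳ us z∈vs

length-++-∷ : ∀ {A : Set} (us vs : List A) x →
              length (us ++ x ∷ vs) ≡ suc (length (us ++ vs))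
length-++-∷ us vs x = begin
  length (us ++ x ∷ vs)        ≡⟨ length-++ us ⟩
  length us + suc (length vs)  ≡⟨ +-suc (length us) (length vs) ⟩
  suc (length us + length vs)  ≡⟨ cong suc (length-++ us) ⟨
  suc (length (us ++ vs))      ∎
  where open ≡-Reasoning

Unique-⊆⇒length≤ : ∀ {A : Set} {xs ys : List A} → Unique xs → xs ⊆ ys → length xs ≤ length ys
Unique-⊆⇒length≤ {xs = []}     _             _ = z≤n
Unique-⊆⇒length≤ {xs = x ∷ xs} (x∉xs ∷ uniq) xs⊆ys
  with us , vs , refl ← ∈-∃++ (xs⊆ys (here refl)) =
  ≤-trans (s≤s (Unique-⊆⇒length≤ uniq xs⊆us++vs)) (≤-reflexive (sym (length-++-∷ us vs x)))
  where
  xs⊆us++vs : xs ⊆ us ++ vs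
  xs⊆us++vs z∈xs = ∈-++-∷-≢ us vs (xs⊆ys (there z∈xs)) (λ z≡x → lookup x∉xs z∈xs (sym z≡x))

drop-length-++ : ∀ {A : Set} (u x : List A) → drop (length u) (u ++ x) ≡ x
drop-length-++ []      x = refl
drop-length-++ (_ ∷ u) x = drop-length-++ u x

take-length-++ : ∀ {A : Set} (u x : List A) → take (length u) (u ++ x) ≡ u
take-length-++ []      x = refl
take-length-++ (a ∷ u) x = cong (a ∷_) (take-length-++ u x)

replicate-+ : ∀ {A : Set} m n (x : A) → replicate (m + n) x ≡ replicate m x ++ replicate n x
replicate-+ zero    n x = refl
replicate-+ (suc m) n x = cong (x ∷_) (replicate-+ m n x)

length-cartesianProduct : ∀ {A B : Set} (xs : List A) (ys : List B) →
                          length (cartesianProduct xs ys) ≡ length xs * length ys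
length-cartesianProduct []       ys = refl
length-cartesianProduct (x ∷ xs) ys = trans (length-++ (map (x ,_) ys))
  (cong₂ _+_ (length-map (x ,_) ys) (length-cartesianProduct xs ys))

IsInfixOf : ∀ {A : Set} → List A → List A → Set
IsInfixOf W w = ∃[ u ] ∃[ v ] w ≡ u ++ W ++ v

IsInfixOf-∷ : ∀ {A : Set} {W w : List A} x → IsInfixOf W w → IsInfixOf W (x ∷ w)
IsInfixOf-∷ x (u , v , refl) = x ∷ u , v , refl

IsInfixOf-++ʳ : ∀ {A : Set} {W w : List A} y → IsInfixOf W w → IsInfixOf W (w ++ y)
IsInfixOf-++ʳ {W = W} y (u , v , refl) =
  u , v ++ y , trans (++-assoc u (W ++ v) y) (cong (u ++_) (++-assoc W v y))

length-≤-IsInfixOf : ∀ {A : Set} {W w : List A} → IsInfixOf W w → length W ≤ length w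
length-≤-IsInfixOf {W = W} (u , v , refl) = begin
  length W                         ≤⟨ m≤n+m (length W) (length u) ⟩
  length u + length W              ≤⟨ +-monoʳ-≤ (length u) (m≤m+n (length W) (length v)) ⟩
  length u + (length W + length v) ≡⟨ cong (λ n → length u + n) (length-++ W) ⟨
  length u + length (W ++ v)       ≡⟨ length-++ u ⟨
  length (u ++ W ++ v)             ∎
  where open ≤-Reasoning

∈-windows : ∀ {W w} → IsInfixOf W w → W ∈ windows (length W) w
∈-windows {W = W} (u , v , refl) =
  subst (_∈ windows (length W) (u ++ W ++ v)) window-at-u (∈-map⁺ _ (∈-upTo⁺ u<bound))
  where
  window-at-u : take (length W) (drop (length u) (u ++ W ++ v)) ≡ W
  window-at-u = trans (cong (take (length W)) (drop-length-++ u (W ++ v))) (take-length-++ W v)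
  u<bound : length u < suc (length (u ++ W ++ v)) ∸ length W
  u<bound = begin-strict
    length u                                         <⟨ s≤s (m≤m+n (length u) (length v)) ⟩
    suc (length u + length v)                        ≡⟨ m+n∸n≡m _ (length W) ⟨
    suc (length u + length v) + length W ∸ length W  ≡⟨ cong (λ n → suc n ∸ length W) lengths ⟩
    suc (length (u ++ W ++ v)) ∸ length W            ∎
    where
    open ≤-Reasoning
    lengths : length u + length v + length W ≡ length (u ++ W ++ v)
    lengths rewrite length-++ u {W ++ v} | length-++ W {v} = swap (length u) (length W) (length v)
      where
      swap : ∀ a b c → a + c + b ≡ a + (b + c)
      swap = solve-∀

distinct-infixes≤S : ∀ {k w} (Ws : List Str) → Unique Ws →
                     (∀ {W} → W ∈ Ws → length W ≡ k × IsInfixOf W w) → length Ws ≤ S w k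
distinct-infixes≤S {k} {w} Ws uniq infixes = Unique-⊆⇒length≤ uniq Ws⊆
  where
  Ws⊆ : Ws ⊆ deduplicate (≡-dec _≟_) (windows k w)
  Ws⊆ W∈Ws with refl , W-infix ← infixes W∈Ws =
    ∈-deduplicate⁺ (≡-dec _≟_) (∈-windows W-infix)

∈⇒≤-foldr-⊔ : ∀ {p} ps → p ∈ ps → p ℚ.≤ foldr _⊔_ 0ℚ ps
∈⇒≤-foldr-⊔ (q ∷ qs) (here refl) = ℚ.p≤p⊔q q _
∈⇒≤-foldr-⊔ (q ∷ qs) (there p∈)  = ℚ.p≤q⇒p≤r⊔q q (∈⇒≤-foldr-⊔ qs p∈)

S/k≤δ : ∀ w {k} .{{_ : NonZero k}} → k ≤ length w → (+ S w k) / k ℚ.≤ δ w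
S/k≤δ w {suc i} k≤|w| =
  ∈⇒≤-foldr-⊔ _ (∈-map⁺ (λ i → (+ S w (suc i)) / suc i) (∈-upTo⁺ k≤|w|))

block : ∀ {A : Set} → A → A → ℕ → List A
block a b j = a ∷ replicate j b

blocks : ∀ {A : Set} → A → A → ℕ → List A
blocks a b zero    = []
blocks a b (suc d) = blocks a b d ++ block a b d

map-blocks : ∀ {A B : Set} (f : A → B) a b d → map f (blocks a b d) ≡ blocks (f a) (f b) d
map-blocks f a b zero    = refl
map-blocks f a b (suc d) = trans (map-++ f (blocks a b d) (block a b d))
  (cong₂ _++_ (map-blocks f a b d) (cong (f a ∷_) (map-replicate f d b)))

length-blocks-suc : ∀ {A : Set} (a b : A) d →
                    length (blocks a b (suc d)) ≡ length (blocks a b d) + suc d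
length-blocks-suc a b d =
  trans (length-++ (blocks a b d)) (cong (λ n → length (blocks a b d) + suc n) (length-replicate d))

d≤length-blocks : ∀ {A : Set} (a b : A) d → d ≤ length (blocks a b d)
d≤length-blocks a b zero    = z≤n
d≤length-blocks a b (suc d) = ≤-trans (m≤n+m (suc d) _) (≤-reflexive (sym (length-blocks-suc a b d)))

length-blocks≤ : ∀ {A : Set} (a b : A) d → length (blocks a b d) ≤ d * d
length-blocks≤ a b zero    = z≤n
length-blocks≤ a b (suc d) = begin
  length (blocks a b (suc d))   ≡⟨ length-blocks-suc a b d ⟩
  length (blocks a b d) + suc d ≤⟨ +-monoˡ-≤ (suc d) (length-blocks≤ a b d) ⟩
  d * d + suc d                 ≤⟨ +-monoˡ-≤ (suc d) (*-monoʳ-≤ d (n≤1+n d)) ⟩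
  d * suc d + suc d             ≡⟨ +-comm (d * suc d) (suc d) ⟩
  suc d * suc d                 ∎
  where open ≤-Reasoning

blocks-+ : ∀ {A : Set} (a b : A) d e → ∃[ rest ] blocks a b (d + e) ≡ blocks a b d ++ rest
blocks-+ a b d zero    = [] , trans (cong (blocks a b) (+-identityʳ d)) (sym (++-identityʳ _))
blocks-+ a b d (suc e) with rest , eq ← blocks-+ a b d e =
  rest ++ block a b (d + e) ,
  trans (cong (blocks a b) (+-suc d e))
        (trans (cong (_++ block a b (d + e)) eq) (++-assoc (blocks a b d) rest _))

window : ∀ {A : Set} → A → A → ℕ → ℕ → ℕ → List A
window a b p q r = replicate p b ++ block a b q ++ block a b r

length-window : ∀ {A : Set} (a b : A) p q r → length (window a b p q r) ≡ p + (suc q + suc r)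
length-window a b p q r
  rewrite length-++ (replicate p b) {block a b q ++ block a b r}
        | length-++ (block a b q) {block a b r}
        | length-replicate p {b} | length-replicate q {b} | length-replicate r {b} = refl

replicate-++-block-injective : ∀ {A : Set} {a b : A} {p p' X X'} → a ≢ b →
  replicate p b ++ a ∷ X ≡ replicate p' b ++ a ∷ X' → p ≡ p' × X ≡ X'
replicate-++-block-injective {p = zero}  {zero}   a≢b eq = refl , ∷-injectiveʳ eq
replicate-++-block-injective {p = zero}  {suc p'} a≢b eq = contradiction (∷-injectiveˡ eq) a≢b
replicate-++-block-injective {p = suc p} {zero}   a≢b eq =
  contradiction (sym (∷-injectiveˡ eq)) a≢b
replicate-++-block-injective {p = suc p} {suc p'} a≢b eq
  with refl , X≡X' ← replicate-++-block-injective {p = p} {p'} a≢b (∷-injectiveʳ eq) =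
  refl , X≡X'

window-injective : ∀ {A : Set} {a b : A} {p q r p' q' r'} → a ≢ b →
  window a b p q r ≡ window a b p' q' r' → p ≡ p' × q ≡ q'
window-injective {p = p} {q} {p' = p'} {q'} a≢b eq
  with refl , rest≡ ← replicate-++-block-injective {p = p} {p'} a≢b eq
  with refl , _ ← replicate-++-block-injective {p = q} {q'} a≢b rest≡ = refl , refl

-- The window is a suffix of block q, the whole block q + 1 and a prefix of block q + 2.
window-IsInfixOf-blocks : ∀ {A : Set} (a b : A) {p q r d} →
  p ≤ q → r ≤ suc (suc q) → 3 + q ≤ d → IsInfixOf (window a b p (suc q) r) (blocks a b d)
window-IsInfixOf-blocks {A} a b {p} {q} {r} {d} p≤q r≤2+q 3+q≤d
  with rest , blocks-d ← blocks-+ a b (3 + q) (d ∸ (3 + q)) =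
  subst (IsInfixOf (window a b p (suc q) r))
        (trans (sym blocks-d) (cong (blocks a b) (m+[n∸m]≡n 3+q≤d)))
        (IsInfixOf-++ʳ rest three-blocks)
  where
  B X₁ Z₂ : List A
  B  = blocks a b q
  X₁ = a ∷ replicate (q ∸ p) b
  Z₂ = replicate (suc (suc q) ∸ r) b
  split-q : block a b q ≡ X₁ ++ replicate p b
  split-q = trans (cong (λ n → a ∷ replicate n b) (sym (m∸n+n≡m p≤q)))
                  (cong (a ∷_) (replicate-+ (q ∸ p) p b))
  split-2+q : block a b (suc (suc q)) ≡ block a b r ++ Z₂
  split-2+q = trans (cong (λ n → a ∷ replicate n b) (sym (m+[n∸m]≡n r≤2+q)))
                    (cong (a ∷_) (replicate-+ r _ b))
  three-blocks : IsInfixOf (window a b p (suc q) r) (blocks a b (3 + q))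
  three-blocks = B ++ X₁ , Z₂ , (begin
    ((B ++ block a b q) ++ block a b (suc q)) ++ block a b (suc (suc q))
      ≡⟨ cong₂ (λ s t → ((B ++ s) ++ block a b (suc q)) ++ t) split-q split-2+q ⟩
    ((B ++ X₁ ++ replicate p b) ++ block a b (suc q)) ++ block a b r ++ Z₂
      ≡⟨ reassociate B X₁ (replicate p b) (block a b (suc q)) (block a b r) Z₂ ⟩
    (B ++ X₁) ++ window a b p (suc q) r ++ Z₂ ∎)
    where
    open ≡-Reasoning
    reassociate : ∀ (B X P Y Z W : List A) →
                  ((B ++ X ++ P) ++ Y) ++ Z ++ W ≡ (B ++ X) ++ (P ++ Y ++ Z) ++ W
    reassociate B X P Y Z W = solve (++-monoid A)

var-a var-b var-c : Fin 3
var-a = zero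
var-b = suc zero
var-c = suc (suc zero)

rule : Fin 3 → List⁺ (Fin 3)
rule zero             = var-a ∷ var-b ∷ []
rule (suc zero)       = var-b ∷ []
rule (suc (suc zero)) = var-c ∷ var-a ∷ []

expand : List (Fin 3) → List (Fin 3)
expand = concatMap (λ A → List⁺.toList (rule A))

expand-replicate-b : ∀ j → expand (replicate j var-b) ≡ replicate j var-b
expand-replicate-b zero    = refl
expand-replicate-b (suc j) = cong (var-b ∷_) (expand-replicate-b j)

-- Each block a b^j grows into a b^(j+1), and the a that c → c a emits becomes the new empty block.
expand-blocks : ∀ d → var-a ∷ expand (blocks var-a var-b d) ≡ blocks var-a var-b (suc d)
expand-blocks zero    = refl
expand-blocks (suc d) =
  trans (cong (var-a ∷_) (concatMap-++ _ (blocks var-a var-b d) (block var-a var-b d)))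
        (cong₂ (λ s t → s ++ var-a ∷ var-b ∷ t) (expand-blocks d) (expand-replicate-b d))

blockSystem : ℕ → LSystem
blockSystem D = record
  { v = 3 ; name = toℕ ; name-inj = toℕ-injective ; R = rule ; axiom = var-c ∷ []
  ; τ = λ A → A ; d = D ; n = suc (length (blocks var-a var-b D)) }

level-blockSystem : ∀ D i → level (blockSystem D) i ≡ var-c ∷ blocks var-a var-b i
level-blockSystem D zero    = refl
level-blockSystem D (suc i) =
  trans (cong expand (level-blockSystem D i)) (cong (var-c ∷_) (expand-blocks i))

word : ℕ → Str
word D = 2 ∷ blocks 0 1 D

blockSystem-generates : ∀ D → Generates (blockSystem D) (word D)
blockSystem-generates D rewrite level-blockSystem D D =
  ≤-refl ,
  trans (cong (map toℕ) (take-all _ (var-c ∷ blocks var-a var-b D) ≤-refl))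
        (cong (2 ∷_) (map-blocks toℕ var-a var-b D))

size-blockSystem : ∀ D → size (blockSystem D) ≡ 6
size-blockSystem D = refl

n<2^n : ∀ n → n < 2 ^ n
n<2^n zero    = s≤s z≤n
n<2^n (suc n) = begin-strict
  suc n           <⟨ +-mono-≤ (m^n>0 2 n) (n<2^n n) ⟩
  2 ^ n + 2 ^ n   ≡⟨ cong (λ x → 2 ^ n + x) (+-identityʳ (2 ^ n)) ⟨
  2 ^ suc n       ∎
  where open ≤-Reasoning

suc[n*n]≤2^[n+n] : ∀ n → suc (n * n) ≤ 2 ^ (n + n)
suc[n*n]≤2^[n+n] n = begin
  suc (n * n)     ≤⟨ s≤s (≤-trans (*-monoʳ-≤ n (n≤1+n n)) (m≤n+m (n * suc n) n)) ⟩
  suc n * suc n   ≤⟨ *-mono-≤ (n<2^n n) (n<2^n n) ⟩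
  2 ^ n * 2 ^ n   ≡⟨ ^-distribˡ-+-* 2 n n ⟨
  2 ^ (n + n)     ∎
  where open ≤-Reasoning

⌊log₂⌋≤ : ∀ {n e} → n ≤ 2 ^ e → ⌊log₂ n ⌋ ≤ e
⌊log₂⌋≤ {e = e} n≤2^e = ≤-trans (⌊log₂⌋-mono-≤ n≤2^e) (≤-reflexive (⌊log₂[2^n]⌋≡n e))

⌊log₂⌋-length-word≤ : ∀ D → ⌊log₂ (length (word D)) ⌋ ≤ D + D
⌊log₂⌋-length-word≤ D = ⌊log₂⌋≤ (≤-trans (s≤s (length-blocks≤ 0 1 D)) (suc[n*n]≤2^[n+n] D))

familyWord : ℕ → Str
familyWord g = word (3 * suc g + 1)

-- The truncated subtraction pads every window with p, j ≤ g to the common length 4 (g + 1).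
pairWindow : ℕ → ℕ → ℕ → Str
pairWindow g p j = window 0 1 p (suc (suc g + g + j)) (2 * g ∸ (j + p))

module _ {g p j : ℕ} (p≤g : p ≤ g) (j≤g : j ≤ g) where

  length-pairWindow : length (pairWindow g p j) ≡ 4 * suc g
  length-pairWindow = begin
    length (pairWindow g p j)                ≡⟨ length-window 0 1 p (suc (suc g + g + j)) r ⟩
    p + (suc (suc (suc g + g + j)) + suc r)  ≡⟨ rearrange g p j r ⟩
    r + (j + p) + (2 * g + 4)                ≡⟨ cong (_+ (2 * g + 4)) (m∸n+n≡m j+p≤2g) ⟩
    2 * g + (2 * g + 4)                      ≡⟨ double g ⟩
    4 * suc g                                ∎
    where
    open ≡-Reasoning
    r : ℕ
    r = 2 * g ∸ (j + p)
    j+p≤2g : j + p ≤ 2 * g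
    j+p≤2g = ≤-trans (+-mono-≤ j≤g p≤g) (≤-reflexive (cong (λ n → g + n) (sym (+-identityʳ g))))
    rearrange : ∀ g p j r → p + (suc (suc (suc g + g + j)) + suc r) ≡ r + (j + p) + (2 * g + 4)
    rearrange = solve-∀
    double : ∀ g → 2 * g + (2 * g + 4) ≡ 4 * suc g
    double = solve-∀

  pairWindow-IsInfixOf : IsInfixOf (pairWindow g p j) (familyWord g)
  pairWindow-IsInfixOf = IsInfixOf-∷ 2 (window-IsInfixOf-blocks 0 1 p≤q r≤2+q 3+q≤D)
    where
    p≤q : p ≤ suc g + g + j
    p≤q = ≤-trans p≤g (≤-trans (m≤n+m g (suc g)) (m≤m+n (suc g + g) j))
    r≤2+q : 2 * g ∸ (j + p) ≤ suc (suc (suc g + g + j))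
    r≤2+q = ≤-trans (m∸n≤m (2 * g) (j + p))
                    (≤-trans (m≤m+n (2 * g) (3 + j)) (≤-reflexive (expand-2+q g j)))
      where
      expand-2+q : ∀ g j → 2 * g + (3 + j) ≡ suc (suc (suc g + g + j))
      expand-2+q = solve-∀
    3+q≤D : 3 + (suc g + g + j) ≤ 3 * suc g + 1
    3+q≤D = ≤-trans (+-monoʳ-≤ (3 + (suc g + g)) j≤g) (≤-reflexive (expand-D g))
      where
      expand-D : ∀ g → 3 + (suc g + g) + g ≡ 3 * suc g + 1
      expand-D = solve-∀

pairWindow-injective : ∀ {g p j p' j'} →
                       pairWindow g p j ≡ pairWindow g p' j' → (p , j) ≡ (p' , j')
pairWindow-injective {g} {j = j} {j' = j'} eq
  with refl , q≡q' ← window-injective (λ ()) eq =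
  ×-≡,≡→≡ (refl , +-cancelˡ-≡ (suc g + g) j j' (suc-injective q≡q'))

pairWindows : ℕ → List Str
pairWindows g = map (uncurry (pairWindow g)) (cartesianProduct (upTo (suc g)) (upTo (suc g)))

Unique-pairWindows : ∀ g → Unique (pairWindows g)
Unique-pairWindows g = Unique.map⁺ (pairWindow-injective {g})
  (Unique.cartesianProduct⁺ (Unique.upTo⁺ (suc g)) (Unique.upTo⁺ (suc g)))

length-pairWindows : ∀ g → length (pairWindows g) ≡ suc g * suc g
length-pairWindows g = begin
  length (pairWindows g)                     ≡⟨ length-map _ (cartesianProduct indices indices) ⟩
  length (cartesianProduct indices indices)  ≡⟨ length-cartesianProduct indices indices ⟩
  length indices * length indices            ≡⟨ cong₂ _*_ (length-upTo (suc g)) (length-upTo (suc g)) ⟩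
  suc g * suc g                              ∎
  where
  open ≡-Reasoning
  indices : List ℕ
  indices = upTo (suc g)

square≤S-familyWord : ∀ g → suc g * suc g ≤ S (familyWord g) (4 * suc g)
square≤S-familyWord g = ≤-trans (≤-reflexive (sym (length-pairWindows g)))
  (distinct-infixes≤S (pairWindows g) (Unique-pairWindows g) infixes)
  where
  infixes : ∀ {W} → W ∈ pairWindows g → length W ≡ 4 * suc g × IsInfixOf W (familyWord g)
  infixes W∈ with (p , j) , pj∈ , refl ← ∈-map⁻ _ W∈
             with p∈ , j∈ ← ∈-cartesianProduct⁻ (upTo (suc g)) (upTo (suc g)) pj∈ =
    length-pairWindow p≤g j≤g , pairWindow-IsInfixOf p≤g j≤g
    where
    p≤g : p ≤ g
    p≤g = s≤s⁻¹ (∈-upTo⁻ p∈)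
    j≤g : j ≤ g
    j≤g = s≤s⁻¹ (∈-upTo⁻ j∈)

Family : Str → Set
Family w = ∃[ g ] w ≡ familyWord g

g≤length-familyWord : ∀ g → g ≤ length (familyWord g)
g≤length-familyWord g = ≤-trans g≤D (≤-trans (d≤length-blocks 0 1 (3 * suc g + 1)) (n≤1+n _))
  where
  g≤D : g ≤ 3 * suc g + 1
  g≤D = ≤-trans (m≤n+m g (suc (2 * g + 3))) (≤-reflexive (D-as-sum g))
    where
    D-as-sum : ∀ g → suc (2 * g + 3) + g ≡ 3 * suc g + 1
    D-as-sum = solve-∀

k≤length-familyWord : ∀ g → 4 * suc g ≤ length (familyWord g)
k≤length-familyWord g = ≤-trans (≤-reflexive (sym (length-pairWindow z≤n z≤n)))
  (length-≤-IsInfixOf (pairWindow-IsInfixOf {g} z≤n z≤n))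

⌊log₂⌋-length-familyWord≤ : ∀ g → ⌊log₂ (length (familyWord g)) ⌋ ≤ 8 * suc g
⌊log₂⌋-length-familyWord≤ g = ≤-trans (⌊log₂⌋-length-word≤ (3 * suc g + 1))
  (≤-trans (m≤m+n _ (2 * g)) (≤-reflexive (2D-as-sum g)))
  where
  2D-as-sum : ∀ g → 3 * suc g + 1 + (3 * suc g + 1) + 2 * g ≡ 8 * suc g
  2D-as-sum = solve-∀

C₀ : ℚ
C₀ = + 1 / 192

C₀*m*L≤s/k : ∀ m L s k .{{_ : NonZero k}} → m * L * k ≤ s * 192 →
            (C₀ ℚ.* ((+ m) / 1)) ℚ.* ((+ L) / 1) ℚ.≤ (+ s) / k
-- ℚ's _/_ normalises, so the comparison is made between unnormalised representatives.
C₀*m*L≤s/k m L s k@(suc k-1) mLk≤s*192 = ℚ.toℚᵘ-cancel-≤ (begin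
  ℚ.toℚᵘ ((C₀ ℚ.* ((+ m) / 1)) ℚ.* ((+ L) / 1))
    ≃⟨ ℚ.toℚᵘ-homo-* (C₀ ℚ.* ((+ m) / 1)) ((+ L) / 1) ⟩
  ℚ.toℚᵘ (C₀ ℚ.* ((+ m) / 1)) ℚᵘ.* ℚ.toℚᵘ ((+ L) / 1)
    ≃⟨ ℚᵘ.*-cong (ℚ.toℚᵘ-homo-* C₀ ((+ m) / 1)) (ℚ.toℚᵘ-fromℚᵘ (mkℚᵘ (+ L) 0)) ⟩
  (ℚ.toℚᵘ C₀ ℚᵘ.* ℚ.toℚᵘ ((+ m) / 1)) ℚᵘ.* mkℚᵘ (+ L) 0
    ≃⟨ ℚᵘ.*-congʳ (ℚᵘ.*-cong (ℚ.toℚᵘ-fromℚᵘ (mkℚᵘ (+ 1) 191))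
                              (ℚ.toℚᵘ-fromℚᵘ (mkℚᵘ (+ m) 0))) ⟩
  (mkℚᵘ (+ 1) 191 ℚᵘ.* mkℚᵘ (+ m) 0) ℚᵘ.* mkℚᵘ (+ L) 0
    ≤⟨ *≤* integer-form ⟩
  mkℚᵘ (+ s) k-1
    ≃⟨ ℚ.toℚᵘ-fromℚᵘ (mkℚᵘ (+ s) k-1) ⟨
  ℚ.toℚᵘ ((+ s) / k) ∎)
  where
  open ℚᵘ.≤-Reasoning
  integer-form : ((+ 1 ℤ.* + m) ℤ.* + L) ℤ.* + k ℤ.≤ + s ℤ.* + 192
  integer-form = subst₂ ℤ._≤_ (sym naturals) (ℤ.pos-* s 192) (ℤ.+≤+ mLk≤s*192)
    where
    naturals : ((+ 1 ℤ.* + m) ℤ.* + L) ℤ.* + k ≡ + (m * L * k)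
    naturals = trans (cong (λ i → (i ℤ.* + L) ℤ.* + k) (ℤ.*-identityˡ (+ m)))
                     (trans (cong (ℤ._* (+ k)) (sym (ℤ.pos-* m L))) (sym (ℤ.pos-* (m * L) k)))

m*L*k≤s*192 : ∀ {m L s} h → m ≤ 6 → L ≤ 8 * h → h * h ≤ s → m * L * (4 * h) ≤ s * 192
m*L*k≤s*192 {m} {L} {s} h m≤6 L≤8h h²≤s = begin
  m * L * (4 * h)        ≤⟨ *-monoˡ-≤ (4 * h) (*-mono-≤ m≤6 L≤8h) ⟩
  6 * (8 * h) * (4 * h)  ≡⟨ collect h ⟩
  h * h * 192            ≤⟨ *-monoˡ-≤ 192 h²≤s ⟩
  s * 192                ∎
  where
  open ≤-Reasoning
  collect : ∀ h → 6 * (8 * h) * (4 * h) ≡ h * h * 192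
  collect = solve-∀

Family-δ-bound : ∀ w → Family w → (m : ℕ) → IsMinSize w m →
                 (C₀ ℚ.* ((+ m) / 1)) ℚ.* ((+ ⌊log₂ (length w) ⌋) / 1) ℚ.≤ δ w
Family-δ-bound _ (g , refl) m (_ , minimal) =
  ℚ.≤-trans (C₀*m*L≤s/k m L s k counting) (S/k≤δ w (k≤length-familyWord g))
  where
  w : Str
  w = familyWord g
  k L s : ℕ
  k = 4 * suc g
  L = ⌊log₂ (length w) ⌋
  s = S w k
  m≤6 : m ≤ 6
  m≤6 = subst (m ≤_) (size-blockSystem D)
              (minimal (blockSystem D) (blockSystem-generates D))
    where
    D : ℕ
    D = 3 * suc g + 1
  counting : m * L * k ≤ s * 192
  counting = m*L*k≤s*192 (suc g) m≤6 (⌊log₂⌋-length-familyWord≤ g) (square≤S-familyWord g)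

theorem3 : Σ (Str → Set) λ F →
    ((N : ℕ) → Σ Str (λ w → F w × N ≤ length w)) ×
    Σ ℚ (λ C → (0ℚ ℚ.< C) ×
      ((w : Str) → F w → 2 ≤ length w → (m : ℕ) → IsMinSize w m →
        (C ℚ.* ((+ m) / 1)) ℚ.* ((+ ⌊log₂ (length w) ⌋) / 1) ℚ.≤ δ w))
theorem3 =
  Family ,
  (λ N → familyWord N , (N , refl) , g≤length-familyWord N) ,
  C₀ , ℚ.positive⁻¹ C₀ ,
  λ w w∈F _ → Family-δ-bound w w∈F
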